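{- Let $k\ge3$ and let $\sigma=\sigma_1\cdots\sigma_{k-1}\sigma_k\in\mathfrak S_k$ satisfy $\sigma_{k-1}<\sigma_k$. Let $\pi$ be a permutation of length $n$ with left-to-right maxima decomposition $\pi=M_1B_1\cdots M_tB_t$. Then: (1) Every time a left-to-right maximum $M_i$ is pushed into the $\{312,\sigma\}$-stack, the stack (immediately after the push) contains the elements $M_i,M_{i-1},\dots,M_2,M_1$, reading from top to bottom. Moreover $$\mathrm{out}^{312,\sigma}(\pi)=\tilde B_1\cdots\tilde B_t\,M_t\cdots M_1,$$ where each $\tilde B_i$ is a rearrangement of $B_i$. (2) If $\pi$ is $\{312,\sigma\}$-sortable, then $M_j=n-t+j$ for $j=1,\dots,t$.
   Context: A permutation contains a pattern $\tau$ if it has a subsequence order-isomorphic to $\tau$. For a set $T$ of patterns, a $T$-stack is a stack whose content, read top to bottom, must never contain an occurrence of a pattern of $T$; an input is processed greedily: push the next input element if this creates no forbidden occurrence in the stack, otherwise pop the top element to the output; $\mathrm{out}^T(\pi)$ is the resulting output. The $T$-machine is the $T$-stack followed by a $\{21\}$-stack (classical stack, greedy); $\pi$ is $T$-sortable if the output of the $T$-machine on $\pi$ is the increasing permutation. An entry $\pi_i$ is a left-to-right maximum if $\pi_i>\pi_j$ for all $j<i$. The left-to-right maxima decomposition is $\pi=M_1B_1\cdots M_tB_t$ where $M_1<\cdots<M_t$ are the left-to-right maxima and $B_i$ is the factor between $M_i$ and $M_{i+1}$ ($B_t$ after $M_t$). -}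

module Defs where

open import Data.Nat using (ℕ; zero; suc; _<_; _<ᵇ_)
open import Data.Bool using (if_then_else_)
open import Data.Fin as Fin using (Fin)
open import Data.List using (List; []; _∷_; _++_; length; lookup; applyUpTo)
open import Data.List.Relation.Binary.Permutation.Propositional using (_↭_)
open import Data.List.Relation.Unary.Any using (Any)
open import Data.Product using (Σ; ∃; _×_)
open import Function.Bundles using (_⇔_)
open import Relation.Nullary using (¬_)
open import Relation.Binary.PropositionalEquality using (_≡_)
open import Relation.Binary.Construct.Closure.ReflexiveTransitive using (Star)

IsPerm : ℕ → List ℕ → Set
IsPerm n π = π ↭ applyUpTo suc n

Contains : List ℕ → List ℕ → Set
Contains π τ =
  Σ (Fin (length τ) → Fin (length π)) λ f →
    (∀ i j → i Fin.< j → f i Fin.< f j) ×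
    (∀ i j → (lookup τ i < lookup τ j) ⇔ (lookup π (f i) < lookup π (f j)))

-- The stack content (read top to bottom, head = top) contains a pattern of T.
Forbidden : List (List ℕ) → List ℕ → Set
Forbidden T s = Any (Contains s) T

record Config : Set where
  constructor cfg
  field
    input  : List ℕ
    stack  : List ℕ
    output : List ℕ

data Step (T : List (List ℕ)) : Config → Config → Set where
  push     : ∀ {x inp st out} → ¬ Forbidden T (x ∷ st) →
             Step T (cfg (x ∷ inp) st out) (cfg inp (x ∷ st) out)
  popBlock : ∀ {x inp y st out} → Forbidden T (x ∷ y ∷ st) →
             Step T (cfg (x ∷ inp) (y ∷ st) out) (cfg (x ∷ inp) st (out ++ y ∷ []))
  popEnd   : ∀ {y st out} →
             Step T (cfg [] (y ∷ st) out) (cfg [] st (out ++ y ∷ []))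

Reach : List (List ℕ) → List ℕ → Config → Set
Reach T π c = Star (Step T) (cfg π [] []) c

Out : List (List ℕ) → List ℕ → List ℕ → Set
Out T π out = Reach T π (cfg [] [] out)

p21 : List ℕ
p21 = 2 ∷ 1 ∷ []

p312 : List ℕ
p312 = 3 ∷ 1 ∷ 2 ∷ []

Sortable : List (List ℕ) → List ℕ → Set
Sortable T π = ∃ λ o₁ → ∃ λ o₂ →
  Out T π o₁ × Out (p21 ∷ []) o₁ o₂ × o₂ ≡ applyUpTo suc (length π)

-- Left-to-right maxima of π, in order of occurrence (entries are ≥ 1, so the
-- running maximum starts at 0).
ltrMaxAux : ℕ → List ℕ → List ℕ
ltrMaxAux m [] = []
ltrMaxAux m (x ∷ xs) = if m <ᵇ x then x ∷ ltrMaxAux x xs else ltrMaxAux m xs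

ltrMaxima : List ℕ → List ℕ
ltrMaxima π = ltrMaxAux 0 π

LastTwoAscending : List ℕ → Set
LastTwoAscending σ = ∃ λ pre → ∃ λ a → ∃ λ b → σ ≡ pre ++ a ∷ b ∷ [] × a < b

module Submission where

-- Both patterns 312 and σ have an ascent after their first entry, so a stack that is decreasing
-- below its top never contains them. Hence, while a block Bᵢ is read, only block entries are
-- popped and the maxima Mᵢ > ⋯ > M₁ stay at the bottom of the stack. When Mᵢ₊₁ arrives, a
-- leftover block entry c on top sits above some Mⱼ > c, and Mᵢ₊₁ c Mⱼ would be a 312; so the
-- block is popped first and Mᵢ₊₁ lands on Mᵢ. For (2): a block entry z above M₁
-- lies below the maximum Mⱼ of its block, j > 1, and z Mⱼ M₁ is a 231 in the output, which no
-- classical stack sorts. So the n − t block entries lie below M₁ < ⋯ < Mₜ, and counting the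
-- entries below Mⱼ in the permutation of 1, …, n gives Mⱼ = n − t + j.

open import Defs
open import Data.Nat using (ℕ; suc; _≤_; _∸_; _+_)
open import Data.Fin using (Fin; toℕ)
open import Data.List using (List; []; _∷_; _++_; length; lookup; take; reverse; concat; zipWith)
open import Data.List.Relation.Binary.Pointwise using (Pointwise)
open import Data.List.Relation.Binary.Permutation.Propositional using (_↭_)
open import Data.Product using (∃; _×_)
open import Relation.Nullary using (¬_)
open import Relation.Binary.PropositionalEquality using (_≡_)

open import Data.Bool using (true; false) renaming (T to IsTrue)
open import Data.Empty using (⊥-elim)
open import Data.Fin as Fin using (zero; suc)
open import Data.List using ([_]; filter; applyUpTo)
import Data.List.Properties as List
open import Data.List.Membership.Propositional using (_∈_; _∉_; find)
open import Data.List.Membership.Propositional.Properties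
  using (∈-++⁺ˡ; ∈-++⁺ʳ; ∈-++⁻; ∈-lookup; ∈-∃++; ∈-applyUpTo⁻)
open import Data.List.Relation.Binary.Permutation.Propositional using (↭⇒↭ₛ; ↭-sym; ↭-trans; ↭-refl; prep)
import Data.List.Relation.Binary.Permutation.Propositional.Properties as ↭
import Data.List.Relation.Binary.Permutation.Setoid.Properties as ↭ₛ
open import Data.List.Relation.Binary.Pointwise as Pointwise using ([]; _∷_)
open import Data.List.Relation.Unary.All as All using (All; []; _∷_; all?)
import Data.List.Relation.Unary.All.Properties as AllP
open import Data.List.Relation.Unary.AllPairs as AllPairs using (AllPairs; []; _∷_)
import Data.List.Relation.Unary.AllPairs.Properties as AllPairsP
open import Data.List.Relation.Unary.Any as Any using (Any; here; there)
open import Data.List.Relation.Unary.Any.Properties using (lookup-index)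
open import Data.List.Relation.Unary.Unique.Propositional using (Unique)
import Data.List.Relation.Unary.Unique.Propositional.Properties as UniqueP
open import Data.Nat using (zero; _<_; _>_; z≤n; s≤s; _≤?_; _<?_; _<ᵇ_; _⊓_)
import Data.Nat.Properties as ℕ
open import Data.Product using (_,_; proj₁; proj₂)
open import Data.Sum using (_⊎_; inj₁; inj₂)
open import Data.Unit using (tt)
open import Function using (_∘_)
open import Function.Bundles using (_⇔_; mk⇔; Equivalence)
open import Relation.Binary.Construct.Closure.ReflexiveTransitive using (Star; ε; _◅_)
open import Relation.Binary.Definitions using (tri<; tri≈; tri>)
open import Relation.Binary.PropositionalEquality
  using (module ≡-Reasoning; _≢_; refl; sym; trans; cong; cong₂; subst; subst₂; setoid)
open import Relation.Nullary using (yes; no)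
Unique-resp-↭ : {A : Set} {xs ys : List A} → xs ↭ ys → Unique xs → Unique ys
Unique-resp-↭ {A} xs↭ys = ↭ₛ.Unique-resp-↭ (setoid A) (↭⇒↭ₛ xs↭ys)

AllPairs-lookup : {A : Set} {R : A → A → Set} {xs : List A} → AllPairs R xs →
                  {i j : Fin (length xs)} → i Fin.< j → R (lookup xs i) (lookup xs j)
AllPairs-lookup (Rx ∷ _) {zero} {suc j} _ = All.lookup Rx (∈-lookup j)
AllPairs-lookup (_ ∷ Rxs) {suc i} {suc j} (s≤s i<j) = AllPairs-lookup Rxs i<j

AllPairs-++⁻ : {A : Set} {R : A → A → Set} (xs : List A) {ys : List A} → AllPairs R (xs ++ ys) →
               AllPairs R xs × AllPairs R ys × All (λ x → All (R x) ys) xs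
AllPairs-++⁻ [] Rys = [] , Rys , []
AllPairs-++⁻ (x ∷ xs) (Rx ∷ Rxsys) with AllPairs-++⁻ xs Rxsys
... | Rxs , Rys , Rxsys′ = (AllP.++⁻ˡ xs Rx ∷ Rxs) , Rys , (AllP.++⁻ʳ xs Rx ∷ Rxsys′)

Unique-disjoint : {A : Set} (xs : List A) {ys : List A} {x : A} → Unique (xs ++ ys) → x ∈ xs → x ∉ ys
Unique-disjoint xs u x∈xs x∈ys with _ , _ , apart ← AllPairs-++⁻ xs u =
  All.lookup (All.lookup apart x∈xs) x∈ys refl

take-through-unique : {A : Set} {L : List A} (xs : List A) {x : A} {ys : List A} →
                      L ≡ xs ++ x ∷ ys → (i : Fin (length L)) → Unique L → lookup L i ≡ x →
                      take (suc (toℕ i)) L ≡ xs ++ [ x ]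
take-through-unique [] refl zero _ _ = refl
take-through-unique [] refl (suc i) (x∉ys ∷ _) eq = ⊥-elim (All.lookup x∉ys (∈-lookup i) (sym eq))
take-through-unique (y ∷ xs) refl zero (y∉ ∷ _) refl = ⊥-elim (All.lookup y∉ (∈-++⁺ʳ xs (here refl)) refl)
take-through-unique (y ∷ xs) refl (suc i) (_ ∷ u) eq = cong (y ∷_) (take-through-unique xs refl i u eq)

concat-snoc : {A : Set} (Xss : List (List A)) (Xs : List A) → concat (Xss ++ [ Xs ]) ≡ concat Xss ++ Xs
concat-snoc Xss Xs = trans (sym (List.concat-++ Xss [ Xs ])) (cong (concat Xss ++_) (List.++-identityʳ Xs))

concat-↭ : {A : Set} {Xss Yss : List (List A)} → Pointwise _↭_ Xss Yss → concat Xss ↭ concat Yss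
concat-↭ [] = ↭-refl
concat-↭ (Xs↭Ys ∷ rest) = ↭.++⁺ Xs↭Ys (concat-↭ rest)

concat-drop-[] : {A : Set} {Xss Yss : List (List A)} → Pointwise _↭_ Xss ([] ∷ Yss) →
                 ∃ λ Zss → Pointwise _↭_ Zss Yss × concat Xss ≡ concat Zss
concat-drop-[] {Xss = Xs ∷ Xss} (Xs↭[] ∷ rest) with refl ← ↭.↭-empty-inv Xs↭[] = Xss , rest , refl

reverse-++-increasing : ∀ ms {Mr} → AllPairs _<_ (reverse ms ++ Mr) →
                        AllPairs _>_ ms × All (λ X → All (_< X) ms) Mr × AllPairs _<_ Mr
reverse-++-increasing [] increasing = [] , All.universal (λ _ → []) _ , increasing
reverse-++-increasing (m ∷ ms) {Mr} increasing
  with reverse-++-increasing ms (subst (AllPairs _<_) move-m increasing)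
  where
  move-m : reverse (m ∷ ms) ++ Mr ≡ reverse ms ++ m ∷ Mr
  move-m = trans (cong (_++ Mr) (List.unfold-reverse m ms)) (List.++-assoc (reverse ms) [ m ] Mr)
... | decreasing , (ms<m ∷ ms<Mr) , (m<Mr ∷ increasing′) =
  (ms<m ∷ decreasing) , All.zipWith (λ (m<X , ms<X) → m<X ∷ ms<X) (m<Mr , ms<Mr) , increasing′

-- Occurrences of patterns

-- Order-isomorphism only needs to be checked in one direction when the values of the
-- occurrence are a function of the values of the pattern.
contains-by-embedding : {π τ : List ℕ} (f : Fin (length τ) → Fin (length π)) →
  (∀ i j → i Fin.< j → f i Fin.< f j) → (g : ℕ → ℕ) → (∀ i → lookup π (f i) ≡ g (lookup τ i)) →
  (∀ i j → lookup τ i < lookup τ j → g (lookup τ i) < g (lookup τ j)) → Contains π τ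
contains-by-embedding {π} {τ} f monotone g value order = f , monotone , λ i j →
  subst₂ (λ u v → (lookup τ i < lookup τ j) ⇔ (u < v)) (sym (value i)) (sym (value j))
    (mk⇔ (order i j) (reflect i j))
  where
  reflect : ∀ i j → g (lookup τ i) < g (lookup τ j) → lookup τ i < lookup τ j
  reflect i j gτᵢ<gτⱼ with ℕ.<-cmp (lookup τ i) (lookup τ j)
  ... | tri< τᵢ<τⱼ _ _ = τᵢ<τⱼ
  ... | tri≈ _ τᵢ≡τⱼ _ = ⊥-elim (ℕ.<-irrefl (cong g τᵢ≡τⱼ) gτᵢ<gτⱼ)
  ... | tri> _ _ τⱼ<τᵢ = ⊥-elim (ℕ.<-asym gτᵢ<gτⱼ (order j i τⱼ<τᵢ))

312-occurrence : {X c M : ℕ} {st : List ℕ} → c < M → M < X → M ∈ st → Contains (X ∷ c ∷ st) p312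
312-occurrence {X} {c} {M} {st} c<M M<X M∈st =
  contains-by-embedding position monotone value lookup-position order
  where
  position : Fin 3 → Fin (length (X ∷ c ∷ st))
  position zero = zero
  position (suc zero) = suc zero
  position (suc (suc zero)) = suc (suc (Any.index M∈st))
  monotone : ∀ i j → i Fin.< j → position i Fin.< position j
  monotone zero (suc zero) _ = s≤s z≤n
  monotone zero (suc (suc zero)) _ = s≤s z≤n
  monotone (suc zero) (suc (suc zero)) _ = s≤s (s≤s z≤n)
  monotone zero zero ()
  monotone (suc zero) zero ()
  monotone (suc zero) (suc zero) (s≤s ())
  monotone (suc (suc zero)) zero ()
  monotone (suc (suc zero)) (suc zero) (s≤s ())
  monotone (suc (suc zero)) (suc (suc zero)) (s≤s (s≤s ()))
  value : ℕ → ℕ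
  value 1 = c
  value 2 = M
  value _ = X
  lookup-position : ∀ i → lookup (X ∷ c ∷ st) (position i) ≡ value (lookup p312 i)
  lookup-position zero = refl
  lookup-position (suc zero) = refl
  lookup-position (suc (suc zero)) = sym (lookup-index M∈st)
  order : ∀ i j → lookup p312 i < lookup p312 j → value (lookup p312 i) < value (lookup p312 j)
  order (suc zero) zero _ = ℕ.<-trans c<M M<X
  order (suc zero) (suc (suc zero)) _ = c<M
  order (suc (suc zero)) zero _ = M<X
  order zero zero (s≤s (s≤s (s≤s ())))
  order zero (suc zero) (s≤s ())
  order zero (suc (suc zero)) (s≤s (s≤s ()))
  order (suc zero) (suc zero) (s≤s ())
  order (suc (suc zero)) (suc zero) (s≤s ())
  order (suc (suc zero)) (suc (suc zero)) (s≤s (s≤s ()))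

21-occurrence : {c b : ℕ} {st : List ℕ} → b < c → b ∈ st → Contains (c ∷ st) p21
21-occurrence {c} {b} {st} b<c b∈st =
  contains-by-embedding position monotone value lookup-position order
  where
  position : Fin 2 → Fin (length (c ∷ st))
  position zero = zero
  position (suc zero) = suc (Any.index b∈st)
  monotone : ∀ i j → i Fin.< j → position i Fin.< position j
  monotone zero (suc zero) _ = s≤s z≤n
  monotone zero zero ()
  monotone (suc zero) zero ()
  monotone (suc zero) (suc zero) (s≤s ())
  value : ℕ → ℕ
  value 1 = b
  value _ = c
  lookup-position : ∀ i → lookup (c ∷ st) (position i) ≡ value (lookup p21 i)
  lookup-position zero = refl
  lookup-position (suc zero) = sym (lookup-index b∈st)
  order : ∀ i j → lookup p21 i < lookup p21 j → value (lookup p21 i) < value (lookup p21 j)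
  order (suc zero) zero _ = b<c
  order zero zero (s≤s (s≤s ()))
  order zero (suc zero) (s≤s ())
  order (suc zero) (suc zero) (s≤s ())

record Ascent (τ : List ℕ) : Set where
  constructor ascent
  field
    {lower upper} : Fin (length τ)
    lower<upper   : lower Fin.< upper
    rises         : lookup τ lower < lookup τ upper

ascent-at-end : (pre : List ℕ) {a b : ℕ} → a < b → Ascent (pre ++ a ∷ b ∷ [])
ascent-at-end [] a<b = ascent {lower = zero} {upper = suc zero} (s≤s z≤n) a<b
ascent-at-end (_ ∷ pre) a<b with ascent l<u rises ← ascent-at-end pre a<b = ascent (s≤s l<u) rises

decreasing-avoids-tail-ascent : {τ : List ℕ} {y x : ℕ} {ds : List ℕ} →
                                Ascent τ → AllPairs _>_ ds → ¬ Contains (x ∷ ds) (y ∷ τ)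
decreasing-avoids-tail-ascent {x = x} {ds} (ascent {l} {u} l<u rises) decreasing (f , monotone , iso) =
  no-ascent (f (suc l)) (f (suc u)) (monotone zero (suc l) (s≤s z≤n)) (monotone (suc l) (suc u) (s≤s l<u))
    (Equivalence.to (iso (suc l) (suc u)) rises)
  where
  no-ascent : ∀ p q → f zero Fin.< p → p Fin.< q → ¬ lookup (x ∷ ds) p < lookup (x ∷ ds) q
  no-ascent (suc p) (suc q) _ (s≤s p<q) = ℕ.<-asym (AllPairs-lookup decreasing p<q)

decreasing-stack-accepts : {σ : List ℕ} → 3 ≤ length σ → LastTwoAscending σ →
                           {x : ℕ} {ds : List ℕ} → AllPairs _>_ ds → ¬ Forbidden (p312 ∷ σ ∷ []) (x ∷ ds)
decreasing-stack-accepts _ _ decreasing (here occurrence) =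
  decreasing-avoids-tail-ascent (ascent-at-end [] (s≤s (s≤s z≤n))) decreasing occurrence
decreasing-stack-accepts _ (_ ∷ pre , _ , _ , refl , a<b) decreasing (there (here occurrence)) =
  decreasing-avoids-tail-ascent (ascent-at-end pre a<b) decreasing occurrence
decreasing-stack-accepts (s≤s (s≤s ())) ([] , _ , _ , refl , _) _ (there (here _))

-- Runs of a stack

pending : Config → List ℕ
pending (cfg inp st _) = inp ++ st

step-keeps-pending-unique : ∀ {T c c′} → Step T c c′ → Unique (pending c) → Unique (pending c′)
step-keeps-pending-unique (push {x} {inp} {st} _) = Unique-resp-↭ (↭-sym (↭.shift x inp st))
step-keeps-pending-unique (popBlock {x} {inp} {y} {st} _) u
  with _ ∷ u′ ← Unique-resp-↭ (↭.shift y (x ∷ inp) st) u = u′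
step-keeps-pending-unique popEnd (_ ∷ u) = u

run-keeps-pending-unique : ∀ {T c c′} → Star (Step T) c c′ → Unique (pending c) → Unique (pending c′)
run-keeps-pending-unique ε u = u
run-keeps-pending-unique (s ◅ ss) u = run-keeps-pending-unique ss (step-keeps-pending-unique s u)

Located : ℕ → List ℕ → List ℕ → List ℕ → Set
Located z inp st out = z ∈ inp ⊎ z ∈ st ⊎ z ∈ out

located-push : ∀ {z x inp st out} → Located z (x ∷ inp) st out → Located z inp (x ∷ st) out
located-push (inj₁ (here z≡x)) = inj₂ (inj₁ (here z≡x))
located-push (inj₁ (there z∈inp)) = inj₁ z∈inp
located-push (inj₂ (inj₁ z∈st)) = inj₂ (inj₁ (there z∈st))
located-push (inj₂ (inj₂ z∈out)) = inj₂ (inj₂ z∈out)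

located-pop : ∀ {z inp y st out} → Located z inp (y ∷ st) out → Located z inp st (out ++ [ y ])
located-pop (inj₁ z∈inp) = inj₁ z∈inp
located-pop {out = out} (inj₂ (inj₁ (here z≡y))) = inj₂ (inj₂ (∈-++⁺ʳ out (here z≡y)))
located-pop (inj₂ (inj₁ (there z∈st))) = inj₂ (inj₁ z∈st)
located-pop (inj₂ (inj₂ z∈out)) = inj₂ (inj₂ (∈-++⁺ˡ z∈out))

module Classical-stack {c : ℕ} {w : List ℕ} {b a : ℕ} (a∈w : a ∈ w) (b<c : b < c) where

  T₂₁ : List (List ℕ)
  T₂₁ = p21 ∷ []

  data BeforeC : Config → Set where
    before : ∀ {q st out} → Located b q st out → BeforeC (cfg (q ++ c ∷ w) st out)

  data AfterC : Config → Set where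
    after : ∀ {inp st out opre opost} → out ≡ opre ++ opost → b ∈ opre → Located a inp st opost →
            AfterC (cfg inp st out)

  after-pop : ∀ {inp y st out} → AfterC (cfg inp (y ∷ st) out) → AfterC (cfg inp st (out ++ [ y ]))
  after-pop {y = y} (after {opre = opre} {opost} out≡ b∈opre loc) =
    after (trans (cong (_++ [ y ]) out≡) (List.++-assoc opre opost [ y ])) b∈opre (located-pop loc)

  after-step : ∀ {C C′} → AfterC C → Step T₂₁ C C′ → AfterC C′
  after-step (after out≡ b∈opre loc) (push _) = after out≡ b∈opre (located-push loc)
  after-step A (popBlock _) = after-pop A
  after-step A popEnd = after-pop A

  -- c cannot be pushed while b is on the stack, as c above b is a 21.
  before-step : ∀ {C C′} → BeforeC C → Step T₂₁ C C′ → BeforeC C′ ⊎ AfterC C′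
  before-step (before {_ ∷ _} loc) (popBlock _) = inj₁ (before (located-pop loc))
  before-step (before {[]} loc) (popBlock _) = inj₁ (before (located-pop loc))
  before-step (before {_ ∷ _} loc) (push _) = inj₁ (before (located-push loc))
  before-step (before {[]} {st} {out} loc) (push accepted) =
    inj₂ (after (sym (List.++-identityʳ out)) (b-output loc) (inj₁ a∈w))
    where
    b-output : Located b [] st out → b ∈ out
    b-output (inj₂ (inj₁ b∈st)) = ⊥-elim (accepted (here (21-occurrence b<c b∈st)))
    b-output (inj₂ (inj₂ b∈out)) = b∈out

  run : ∀ {C C′} → Star (Step T₂₁) C C′ → BeforeC C ⊎ AfterC C → BeforeC C′ ⊎ AfterC C′
  run ε I = I
  run (s ◅ ss) (inj₁ B) = run ss (before-step B s)
  run (s ◅ ss) (inj₂ A) = run ss (inj₂ (after-step A s))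

  before-has-input : ∀ {C} → BeforeC C → Config.input C ≢ []
  before-has-input (before {[]} _) ()
  before-has-input (before {_ ∷ _} _) ()

sortable-avoids-231 : ∀ {X c w b a o} → Out (p21 ∷ []) (X ++ c ∷ w) o → AllPairs _<_ o →
                      b ∈ X → a ∈ w → b < c → b < a
sortable-avoids-231 run o-increasing b∈X a∈w b<c
  with Classical-stack.run a∈w b<c run (inj₁ (Classical-stack.before (inj₁ b∈X)))
... | inj₁ B = ⊥-elim (Classical-stack.before-has-input a∈w b<c B refl)
... | inj₂ (Classical-stack.after {opre = opre} refl b∈opre (inj₂ (inj₂ a∈opost))) =
  All.lookup (All.lookup (proj₂ (proj₂ (AllPairs-++⁻ opre o-increasing))) b∈opre) a∈opost

-- Left-to-right maxima

assemble : List ℕ → List (List ℕ) → List ℕ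
assemble Ms Bs = concat (zipWith _∷_ Ms Bs)

BlocksBelow : List ℕ → List (List ℕ) → Set
BlocksBelow = Pointwise (λ M B → All (_< M) B)

ltrMaxAux-⊆ : ∀ m xs {z} → z ∈ ltrMaxAux m xs → z ∈ xs
ltrMaxAux-⊆ m (x ∷ xs) z∈ with m <ᵇ x
ltrMaxAux-⊆ m (x ∷ xs) (here z≡x) | true = here z≡x
ltrMaxAux-⊆ m (x ∷ xs) (there z∈) | true = there (ltrMaxAux-⊆ x xs z∈)
... | false = there (ltrMaxAux-⊆ m xs z∈)

ltrMaxAux-skip : ∀ m B ys → All (_≤ m) B → ltrMaxAux m (B ++ ys) ≡ ltrMaxAux m ys
ltrMaxAux-skip m [] ys [] = refl
ltrMaxAux-skip m (x ∷ B) ys (x≤m ∷ B≤m) with m <ᵇ x in m<ᵇx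
... | true = ⊥-elim (ℕ.<⇒≱ (ℕ.<ᵇ⇒< m x (subst IsTrue (sym m<ᵇx) tt)) x≤m)
... | false = ltrMaxAux-skip m B ys B≤m

ltrMaxAux-first : ∀ m B ys → Any (m <_) B → ∃ λ z → z ∈ B × ∃ λ zs → ltrMaxAux m (B ++ ys) ≡ z ∷ zs
ltrMaxAux-first m (x ∷ B) ys above with m <ᵇ x in m<ᵇx
... | true = x , here refl , _ , refl
... | false with above
...   | here m<x = ⊥-elim (subst IsTrue m<ᵇx (ℕ.<⇒<ᵇ m<x))
...   | there above′ with z , z∈B , zs , eq ← ltrMaxAux-first m B ys above′ = z , there z∈B , zs , eq

ltrMaxAux-block-exceeds : ∀ M B Ms Bs → length Bs ≡ length Ms → Unique (B ++ assemble Ms Bs) →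
                          ltrMaxAux M (B ++ assemble Ms Bs) ≡ Ms → ¬ Any (M <_) B
ltrMaxAux-block-exceeds M B Ms Bs _ _ eq above with ltrMaxAux-first M B (assemble Ms Bs) above
ltrMaxAux-block-exceeds M B [] [] _ _ eq _ | _ , _ , _ , eq′ with () ← trans (sym eq) eq′
ltrMaxAux-block-exceeds M B (_ ∷ _) (_ ∷ _) _ u eq _ | _ , z∈B , _ , eq′ =
  Unique-disjoint B u z∈B (here (List.∷-injectiveˡ (trans (sym eq′) eq)))

ltrMaxAux-decomposition : ∀ m Ms Bs → length Bs ≡ length Ms → Unique (assemble Ms Bs) →
                          ltrMaxAux m (assemble Ms Bs) ≡ Ms →
                          All (m <_) Ms × AllPairs _<_ Ms × BlocksBelow Ms Bs
ltrMaxAux-decomposition m [] [] _ _ _ = [] , [] , []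
ltrMaxAux-decomposition m (M ∷ Ms) (B ∷ Bs) len (M∉ ∷ u) eq with m <ᵇ M in m<ᵇM
... | false = ⊥-elim (All.lookup M∉ (ltrMaxAux-⊆ m _ (subst (M ∈_) (sym eq) (here refl))) refl)
... | true with all? (_≤? M) B
...   | no B≰M = ⊥-elim (ltrMaxAux-block-exceeds M B Ms Bs (ℕ.suc-injective len) u (List.∷-injectiveʳ eq)
                           (Any.map ℕ.≰⇒> (AllP.¬All⇒Any¬ (_≤? M) B B≰M)))
...   | yes B≤M
  with M<Ms , increasing , below ← ltrMaxAux-decomposition M Ms Bs (ℕ.suc-injective len)
                                     (proj₁ (proj₂ (AllPairs-++⁻ B u)))
                                     (trans (sym (ltrMaxAux-skip M B _ B≤M)) (List.∷-injectiveʳ eq)) =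
  m<M ∷ All.map (ℕ.<-trans m<M) M<Ms , M<Ms ∷ increasing , B<M ∷ below
  where
  m<M : m < M
  m<M = ℕ.<ᵇ⇒< m M (subst IsTrue (sym m<ᵇM) tt)
  B<M : All (_< M) B
  B<M = All.zipWith (λ (B≤M , M≢B) → ℕ.≤∧≢⇒< B≤M (M≢B ∘ sym)) (B≤M , AllP.++⁻ˡ B M∉)

ltrMaxima-decomposition : ∀ Ms Bs → length Bs ≡ length Ms → Unique (assemble Ms Bs) →
                          ltrMaxima (assemble Ms Bs) ≡ Ms → AllPairs _<_ Ms × BlocksBelow Ms Bs
ltrMaxima-decomposition Ms Bs len u eq = proj₂ (ltrMaxAux-decomposition 0 Ms Bs len u eq)

∈-assemble : ∀ {Ms Bs M} → BlocksBelow Ms Bs → M ∈ Ms → M ∈ assemble Ms Bs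
∈-assemble (_ ∷ _) (here refl) = here refl
∈-assemble {Bs = B ∷ _} (_ ∷ below) (there M∈) = there (∈-++⁺ʳ B (∈-assemble below M∈))

assemble-↭ : ∀ {Ms Bs} → BlocksBelow Ms Bs → assemble Ms Bs ↭ Ms ++ concat Bs
assemble-↭ [] = ↭-refl
assemble-↭ {M ∷ Ms} {B ∷ _} (_ ∷ below) = prep M (↭-trans (↭.++⁺ˡ B (assemble-↭ below)) (↭.shifts B Ms))

entry-below-its-maximum : ∀ {Ms Bs z} → BlocksBelow Ms Bs → z ∈ concat Bs → ∃ λ M → M ∈ Ms × z < M
entry-below-its-maximum {M ∷ _} {B ∷ _} (B<M ∷ below) z∈ with ∈-++⁻ B z∈
... | inj₁ z∈B = M , here refl , All.lookup B<M z∈B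
... | inj₂ z∈Bs with M′ , M′∈ , z<M′ ← entry-below-its-maximum below z∈Bs = M′ , there M′∈ , z<M′

sortable-blocks-below-first-maximum : ∀ {M₁ Ms Bs Bts o} → BlocksBelow (M₁ ∷ Ms) Bs → Pointwise _↭_ Bts Bs →
  Out (p21 ∷ []) (concat Bts ++ reverse (M₁ ∷ Ms)) o → AllPairs _<_ o → All (_< M₁) (concat Bs)
sortable-blocks-below-first-maximum {M₁} {Ms} {Bs} {Bts} below Bts↭Bs run o-increasing = All.tabulate below-M₁
  where
  below-M₁ : ∀ {z} → z ∈ concat Bs → z < M₁
  below-M₁ z∈ with entry-below-its-maximum below z∈
  ... | _ , here refl , z<M₁ = z<M₁
  ... | M , there M∈Ms , z<M
    with Y , Z , reverse-Ms≡ ← ∈-∃++ (↭.∈-resp-↭ (↭-sym (↭.↭-reverse Ms)) M∈Ms) =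
    sortable-avoids-231 (subst (λ ι → Out (p21 ∷ []) ι _) input≡ run) o-increasing
      (∈-++⁺ˡ (↭.∈-resp-↭ (↭-sym (concat-↭ Bts↭Bs)) z∈)) (∈-++⁺ʳ Z (here refl)) z<M
    where
    open ≡-Reasoning
    input≡ : concat Bts ++ reverse (M₁ ∷ Ms) ≡ (concat Bts ++ Y) ++ M ∷ Z ++ [ M₁ ]
    input≡ = begin
      concat Bts ++ reverse (M₁ ∷ Ms)      ≡⟨ cong (concat Bts ++_) (List.unfold-reverse M₁ Ms) ⟩
      concat Bts ++ reverse Ms ++ [ M₁ ]   ≡⟨ cong (λ R → concat Bts ++ R ++ [ M₁ ]) reverse-Ms≡ ⟩
      concat Bts ++ (Y ++ M ∷ Z) ++ [ M₁ ] ≡⟨ cong (concat Bts ++_) (List.++-assoc Y (M ∷ Z) [ M₁ ]) ⟩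
      concat Bts ++ Y ++ M ∷ Z ++ [ M₁ ]   ≡⟨ sym (List.++-assoc (concat Bts) Y _) ⟩
      (concat Bts ++ Y) ++ M ∷ Z ++ [ M₁ ] ∎

sortable-blocks-below-maxima : ∀ {Ms Bs Bts o} → BlocksBelow Ms Bs → AllPairs _<_ Ms → Pointwise _↭_ Bts Bs →
  Out (p21 ∷ []) (concat Bts ++ reverse Ms) o → AllPairs _<_ o → All (λ M → All (_< M) (concat Bs)) Ms
sortable-blocks-below-maxima {[]} _ _ _ _ _ = []
sortable-blocks-below-maxima {M₁ ∷ _} {Bs} below (M₁<Ms ∷ _) Bts↭Bs run o-increasing =
  Bs<M₁ ∷ All.map (λ M₁<M → All.map (λ z<M₁ → ℕ.<-trans z<M₁ M₁<M) Bs<M₁) M₁<Ms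
  where
  Bs<M₁ : All (_< M₁) (concat Bs)
  Bs<M₁ = sortable-blocks-below-first-maximum below Bts↭Bs run o-increasing

-- Counting the entries below a value

count-below : ℕ → List ℕ → ℕ
count-below v xs = length (filter (_<? v) xs)

count-below-↭ : ∀ v {xs ys} → xs ↭ ys → count-below v xs ≡ count-below v ys
count-below-↭ v xs↭ys = ↭.↭-length (↭.filter-↭ (_<? v) xs↭ys)

count-below-++ : ∀ v xs {ys} → count-below v (xs ++ ys) ≡ count-below v xs + count-below v ys
count-below-++ v xs {ys} =
  trans (cong length (List.filter-++ (_<? v) xs ys)) (List.length-++ (filter (_<? v) xs))

count-below-all : ∀ {v xs} → All (_< v) xs → count-below v xs ≡ length xs
count-below-all xs<v = cong length (List.filter-all (_<? _) xs<v)

count-below-increasing : ∀ {Ms} → AllPairs _<_ Ms → (j : Fin (length Ms)) →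
                         count-below (lookup Ms j) Ms ≡ toℕ j
count-below-increasing {M ∷ _} (M<Ms ∷ _) zero =
  trans (cong length (List.filter-reject (_<? M) (ℕ.<-irrefl refl)))
        (cong length (List.filter-none (_<? M) (All.map ℕ.<⇒≯ M<Ms)))
count-below-increasing {M ∷ Ms} (M<Ms ∷ increasing) (suc j) =
  trans (cong length (List.filter-accept (_<? lookup Ms j) (All.lookup M<Ms (∈-lookup j))))
        (cong suc (count-below-increasing increasing j))

count-below-upTo : ∀ i n → count-below (suc i) (applyUpTo suc n) ≡ n ⊓ i
count-below-upTo i zero = refl
count-below-upTo i (suc n) = begin
  count-below (suc i) (applyUpTo suc (suc n))
    ≡⟨ cong (count-below (suc i)) (sym (List.applyUpTo-∷ʳ suc n)) ⟩
  count-below (suc i) (applyUpTo suc n ++ [ suc n ])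
    ≡⟨ count-below-++ (suc i) (applyUpTo suc n) ⟩
  count-below (suc i) (applyUpTo suc n) + count-below (suc i) [ suc n ]
    ≡⟨ cong (_+ count-below (suc i) [ suc n ]) (count-below-upTo i n) ⟩
  n ⊓ i + count-below (suc i) [ suc n ]
    ≡⟨ last-entry ⟩
  suc n ⊓ i ∎
  where
  open ≡-Reasoning
  last-entry : n ⊓ i + count-below (suc i) [ suc n ] ≡ suc n ⊓ i
  last-entry with n <? i
  ... | yes n<i = begin
    n ⊓ i + count-below (suc i) [ suc n ]
      ≡⟨ cong₂ _+_ (ℕ.m≤n⇒m⊓n≡m (ℕ.<⇒≤ n<i)) (cong length (List.filter-accept (_<? suc i) (s≤s n<i))) ⟩
    n + 1     ≡⟨ ℕ.+-comm n 1 ⟩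
    suc n     ≡⟨ sym (ℕ.m≤n⇒m⊓n≡m n<i) ⟩
    suc n ⊓ i ∎
  ... | no n≮i = begin
    n ⊓ i + count-below (suc i) [ suc n ]
      ≡⟨ cong₂ _+_ (ℕ.m≥n⇒m⊓n≡n i≤n) (cong length (List.filter-reject (_<? suc i) (n≮i ∘ ℕ.≤-pred))) ⟩
    i + 0     ≡⟨ ℕ.+-identityʳ i ⟩
    i         ≡⟨ sym (ℕ.m≥n⇒m⊓n≡n (ℕ.m≤n⇒m≤1+n i≤n)) ⟩
    suc n ⊓ i ∎
    where
    i≤n : i ≤ n
    i≤n = ℕ.≮⇒≥ n≮i

top-values : ∀ n {π Ms E} → IsPerm n π → π ↭ Ms ++ E → AllPairs _<_ Ms → All (λ M → All (_< M) E) Ms →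
             (j : Fin (length Ms)) → lookup Ms j ≡ n ∸ length Ms + suc (toℕ j)
top-values n {π} {Ms} {E} π↭[1,n] π↭Ms++E increasing E<Ms j
  with i , i<n , Mⱼ≡1+i ← ∈-applyUpTo⁻ suc (↭.∈-resp-↭ π↭[1,n]
                             (↭.∈-resp-↭ (↭-sym π↭Ms++E) (∈-++⁺ˡ (∈-lookup {xs = Ms} j)))) =
  begin
    lookup Ms j                 ≡⟨ Mⱼ≡1+i ⟩
    suc i                       ≡⟨ cong suc i≡j+|E| ⟩
    suc (toℕ j + length E)      ≡⟨ cong suc (ℕ.+-comm (toℕ j) (length E)) ⟩
    suc (length E + toℕ j)      ≡⟨ sym (ℕ.+-suc (length E) (toℕ j)) ⟩
    length E + suc (toℕ j)      ≡⟨ cong (_+ suc (toℕ j)) (sym n∸t≡|E|) ⟩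
    n ∸ length Ms + suc (toℕ j) ∎
  where
  open ≡-Reasoning
  n∸t≡|E| : n ∸ length Ms ≡ length E
  n∸t≡|E| = begin
    n ∸ length Ms                        ≡⟨ cong (_∸ length Ms) (sym (List.length-applyUpTo suc n)) ⟩
    length (applyUpTo suc n) ∸ length Ms ≡⟨ cong (_∸ length Ms) (sym (↭.↭-length π↭[1,n])) ⟩
    length π ∸ length Ms                 ≡⟨ cong (_∸ length Ms) (↭.↭-length π↭Ms++E) ⟩
    length (Ms ++ E) ∸ length Ms         ≡⟨ cong (_∸ length Ms) (List.length-++ Ms) ⟩
    length Ms + length E ∸ length Ms     ≡⟨ ℕ.m+n∸m≡n (length Ms) (length E) ⟩
    length E                             ∎
  i≡j+|E| : i ≡ toℕ j + length E
  i≡j+|E| = begin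
    i                                           ≡⟨ sym (ℕ.m≥n⇒m⊓n≡n (ℕ.<⇒≤ i<n)) ⟩
    n ⊓ i                                       ≡⟨ sym (count-below-upTo i n) ⟩
    count-below (suc i) (applyUpTo suc n)       ≡⟨ cong (λ v → count-below v (applyUpTo suc n)) (sym Mⱼ≡1+i) ⟩
    count-below (lookup Ms j) (applyUpTo suc n) ≡⟨ sym (count-below-↭ _ π↭[1,n]) ⟩
    count-below (lookup Ms j) π                 ≡⟨ count-below-↭ _ π↭Ms++E ⟩
    count-below (lookup Ms j) (Ms ++ E)         ≡⟨ count-below-++ _ Ms ⟩
    count-below (lookup Ms j) Ms + count-below (lookup Ms j) E
      ≡⟨ cong₂ _+_ (count-below-increasing increasing j) (count-below-all (All.lookup E<Ms (∈-lookup j))) ⟩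
    toℕ j + length E                            ∎

-- The {312,σ}-stack

module 312σ-stack {σ : List ℕ} (long : 3 ≤ length σ) (lta : LastTwoAscending σ)
                  {Ms : List ℕ} {Bs : List (List ℕ)}
                  (below : BlocksBelow Ms Bs) (increasing : AllPairs _<_ Ms) where

  T : List (List ℕ)
  T = p312 ∷ σ ∷ []

  Dominated : List ℕ → ℕ → Set
  Dominated ms y = Any (y <_) ms

  -- ms are the maxima pushed so far (top first) and Mr, Br the rest of the decomposition. The
  -- current block is p ++ r, where r is unread and the read part p is split into the output o
  -- and the stacked entries s. Bd are the finished blocks, headed by an empty block that stands
  -- for the time before M₁ is read.
  record Progress (ms Mr : List ℕ) (Br : List (List ℕ)) (r s out : List ℕ) : Set where
    constructor progress
    field
      {p o}             : List ℕ
      {Bd Btd}          : List (List ℕ)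
      maxima-split      : Ms ≡ reverse ms ++ Mr
      rest-below        : BlocksBelow Mr Br
      blocks-split      : [] ∷ Bs ≡ Bd ++ (p ++ r) ∷ Br
      finished-blocks   : Pointwise _↭_ Btd Bd
      current-block     : o ++ s ↭ p
      output            : out ≡ concat Btd ++ o
      stacked-dominated : All (Dominated ms) s
      unread-dominated  : All (Dominated ms) r

  data Reading : Config → Set where
    reading : ∀ {ms Mr Br r s out} → Progress ms Mr Br r s out →
              Reading (cfg (r ++ assemble Mr Br) (s ++ ms) out)

  data Draining : Config → Set where
    draining : ∀ {Bts q st out} → Pointwise _↭_ Bts Bs → q ++ st ≡ reverse Ms → out ≡ concat Bts ++ q →
               Draining (cfg [] st out)

  Invariant : Config → Set
  Invariant c = Reading c ⊎ Draining c

  pop : ∀ {ms Mr Br r y s out} → Progress ms Mr Br r (y ∷ s) out → Progress ms Mr Br r s (out ++ [ y ])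
  pop {y = y} {s} (progress {o = o} {Btd = Btd} ms-split rest blocks finished current output
                            (_ ∷ stacked) unread) =
    progress ms-split rest blocks finished (subst (_↭ _) (sym (List.++-assoc o [ y ] s)) current)
      (trans (cong (_++ [ y ]) output) (List.++-assoc (concat Btd) o [ y ])) stacked unread

  push-entry : ∀ {ms Mr Br b r s out} → Progress ms Mr Br (b ∷ r) s out → Progress ms Mr Br r (b ∷ s) out
  push-entry {Br = Br} {b} {r} {s} (progress {p} {o} {Bd} ms-split rest blocks finished current output
                                             stacked (b-dominated ∷ unread)) =
    progress {p = p ++ [ b ]} ms-split rest
      (trans blocks (cong (λ B → Bd ++ B ∷ Br) (sym (List.++-assoc p [ b ] r))))
      finished (↭-trans (↭.shift b o s) (↭-trans (prep b current) (↭.∷↭∷ʳ b p))) output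
      (b-dominated ∷ stacked) unread

  push-maximum : ∀ {ms X Mr B Br out} → Progress ms (X ∷ Mr) (B ∷ Br) [] [] out →
                 Progress (X ∷ ms) Mr Br B [] out
  push-maximum {ms} {X} {Mr} {B} {Br} {out} (progress {p} {o} {Bd} {Btd} ms-split (B<X ∷ rest) blocks
                                                      finished current output _ _) =
    progress {p = []} {o = []} {Bd = Bd ++ [ p ]} {Btd = Btd ++ [ o ]}
      ms-split′ rest blocks-split′ (Pointwise.++⁺ finished (o↭p ∷ [])) ↭-refl output′ [] (All.map here B<X)
    where
    o↭p : o ↭ p
    o↭p = subst (_↭ p) (List.++-identityʳ o) current
    ms-split′ : Ms ≡ reverse (X ∷ ms) ++ Mr
    ms-split′ = trans ms-split (trans (sym (List.++-assoc (reverse ms) [ X ] Mr))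
                                      (cong (_++ Mr) (sym (List.unfold-reverse X ms))))
    blocks-split′ : [] ∷ Bs ≡ (Bd ++ [ p ]) ++ B ∷ Br
    blocks-split′ = trans blocks (trans (cong (λ C → Bd ++ C ∷ B ∷ Br) (List.++-identityʳ p))
                                        (sym (List.++-assoc Bd [ p ] (B ∷ Br))))
    output′ : out ≡ concat (Btd ++ [ o ]) ++ []
    output′ = trans output (trans (sym (concat-snoc Btd o)) (sym (List.++-identityʳ _)))

  finish : ∀ {ms Br out} → Progress ms [] Br [] [] out → Draining (cfg [] ms out)
  finish {ms} {out = out} (progress {p} {o} {Bd} {Btd} ms-split [] blocks finished current output _ _) =
    let Bts , Bts↭Bs , same = concat-drop-[] (subst (Pointwise _↭_ (Btd ++ [ o ])) all-blocks all-finished) in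
    draining Bts↭Bs ms≡reverse-Ms (begin
      out                   ≡⟨ output ⟩
      concat Btd ++ o       ≡⟨ sym (concat-snoc Btd o) ⟩
      concat (Btd ++ [ o ]) ≡⟨ same ⟩
      concat Bts            ≡⟨ sym (List.++-identityʳ _) ⟩
      concat Bts ++ []      ∎)
    where
    open ≡-Reasoning
    all-finished : Pointwise _↭_ (Btd ++ [ o ]) (Bd ++ [ p ])
    all-finished = Pointwise.++⁺ finished (subst (_↭ p) (List.++-identityʳ o) current ∷ [])
    all-blocks : Bd ++ [ p ] ≡ [] ∷ Bs
    all-blocks = sym (trans blocks (cong (λ C → Bd ++ [ C ]) (List.++-identityʳ p)))
    ms≡reverse-Ms : ms ≡ reverse Ms
    ms≡reverse-Ms = sym (trans (cong reverse (trans ms-split (List.++-identityʳ _)))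
                               (List.reverse-involutive ms))

  maxima-order : ∀ {ms Mr Br r s out} → Progress ms Mr Br r s out →
                 AllPairs _>_ ms × All (λ X → All (_< X) ms) Mr × AllPairs _<_ Mr
  maxima-order P = reverse-++-increasing _ (subst (AllPairs _<_) (Progress.maxima-split P) increasing)

  maxima-accept : ∀ {ms Mr Br r s out x} → Progress ms Mr Br r s out → ¬ Forbidden T (x ∷ ms)
  maxima-accept P = decreasing-stack-accepts long lta (proj₁ (maxima-order P))

  maximum-over-entry-forms-312 : ∀ {ms X Mr Br c s out} → Progress ms (X ∷ Mr) Br [] (c ∷ s) out →
                                 Forbidden T (X ∷ c ∷ s ++ ms)
  maximum-over-entry-forms-312 {s = s} P@(progress _ _ _ _ _ _ (c-dominated ∷ _) _)
    with M , M∈ms , c<M ← find c-dominated | _ , (ms<X ∷ _) , _ ← maxima-order P =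
    here (312-occurrence c<M (All.lookup ms<X M∈ms) (∈-++⁺ʳ s M∈ms))

  draining-step : ∀ {c c′} → Draining c → Step T c c′ → Draining c′
  draining-step (draining {Bts} {q} finished split output) (popEnd {y} {st}) =
    draining finished (trans (List.++-assoc q [ y ] st) split)
      (trans (cong (_++ [ y ]) output) (List.++-assoc (concat Bts) q [ y ]))

  reading-step : ∀ {ms Mr Br r s out c′} → Progress ms Mr Br r s out →
                 Step T (cfg (r ++ assemble Mr Br) (s ++ ms) out) c′ → Invariant c′
  reading-step {_} {_ ∷ _} {[]} P _ with () ← Progress.rest-below P
  reading-step {_} {[]} {_ ∷ _} P _ with () ← Progress.rest-below P
  reading-step {_} {_} {_} {_ ∷ _} {_ ∷ _} P (popBlock _) = inj₁ (reading (pop P))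
  reading-step {_} {_} {_} {_ ∷ _} {_} P (push _) = inj₁ (reading (push-entry P))
  reading-step {_ ∷ _} {_} {_} {_ ∷ _} {[]} P (popBlock F) = ⊥-elim (maxima-accept P F)
  reading-step {_} {_ ∷ _} {_ ∷ _} {[]} {_ ∷ _} P (push accepted) =
    ⊥-elim (accepted (maximum-over-entry-forms-312 P))
  reading-step {_} {_ ∷ _} {_ ∷ _} {[]} {[]} P (push _) = inj₁ (reading (push-maximum P))
  reading-step {_} {_ ∷ _} {_ ∷ _} {[]} {_ ∷ _} P (popBlock _) = inj₁ (reading (pop P))
  reading-step {_ ∷ _} {_ ∷ _} {_ ∷ _} {[]} {[]} P (popBlock F) = ⊥-elim (maxima-accept P F)
  reading-step {_} {[]} {[]} {[]} {_ ∷ _} P popEnd = inj₁ (reading (pop P))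
  reading-step {_ ∷ _} {[]} {[]} {[]} {[]} P popEnd = inj₂ (draining-step (finish P) popEnd)

  invariant-step : ∀ {c c′} → Invariant c → Step T c c′ → Invariant c′
  invariant-step (inj₁ (reading P)) = reading-step P
  invariant-step (inj₂ D) = inj₂ ∘ draining-step D

  invariant-run : ∀ {c c′} → Star (Step T) c c′ → Invariant c → Invariant c′
  invariant-run ε I = I
  invariant-run (s ◅ ss) I = invariant-run ss (invariant-step I s)

  initial : Invariant (cfg (assemble Ms Bs) [] [])
  initial = inj₁ (reading {ms = []} {r = []} {s = []}
                   (progress {p = []} {o = []} {Bd = []} {Btd = []} refl below refl [] ↭-refl refl [] []))

  pushed-maximum-tops-maxima : ∀ {c} → Reading c → Unique (pending c) →
    ∀ {x inp} → Config.input c ≡ x ∷ inp → ¬ Forbidden T (x ∷ Config.stack c) →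
    (i : Fin (length Ms)) → x ≡ lookup Ms i → x ∷ Config.stack c ≡ reverse (take (suc (toℕ i)) Ms)
  pushed-maximum-tops-maxima (reading {ms} {Mr} {Br} {_ ∷ r} {s} P) (b∉ ∷ _) refl _ i b≡Mᵢ =
    ⊥-elim (All.lookup b∉ Mᵢ-pending b≡Mᵢ)
    where
    Mᵢ-pending : lookup Ms i ∈ (r ++ assemble Mr Br) ++ s ++ ms
    Mᵢ-pending with ∈-++⁻ (reverse ms) (subst (lookup Ms i ∈_) (Progress.maxima-split P) (∈-lookup i))
    ... | inj₁ in-ms = ∈-++⁺ʳ (r ++ _) (∈-++⁺ʳ s (↭.∈-resp-↭ (↭.↭-reverse ms) in-ms))
    ... | inj₂ in-Mr = ∈-++⁺ˡ (∈-++⁺ʳ r (∈-assemble (Progress.rest-below P) in-Mr))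
  pushed-maximum-tops-maxima (reading {_} {_ ∷ _} {_ ∷ _} {[]} {_ ∷ _} P) _ refl accepted =
    ⊥-elim (accepted (maximum-over-entry-forms-312 P))
  pushed-maximum-tops-maxima (reading {ms} {X ∷ Mr} {_ ∷ _} {[]} {[]} P) _ refl _ i X≡Mᵢ = begin
    X ∷ ms                          ≡⟨ cong (X ∷_) (sym (List.reverse-involutive ms)) ⟩
    X ∷ reverse (reverse ms)        ≡⟨ sym (List.reverse-++ (reverse ms) [ X ]) ⟩
    reverse (reverse ms ++ [ X ])   ≡⟨ cong reverse (sym (take-through-unique (reverse ms)
                                         (Progress.maxima-split P) i Ms-unique (sym X≡Mᵢ))) ⟩
    reverse (take (suc (toℕ i)) Ms) ∎
    where
    open ≡-Reasoning
    Ms-unique : Unique Ms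
    Ms-unique = AllPairs.map ℕ.<⇒≢ increasing
  pushed-maximum-tops-maxima (reading {_} {[]} {_} {[]} P) _ ()
  pushed-maximum-tops-maxima (reading {_} {_ ∷ _} {[]} {[]} P) _ ()

  exhausted-reading : ∀ {c} → Reading c → Config.input c ≡ [] → Config.stack c ≡ [] → Draining c
  exhausted-reading (reading {[]} {[]} {[]} {[]} {[]} P) refl refl = finish P
  exhausted-reading (reading {_} {[]} {_ ∷ _} P) _ _ with () ← Progress.rest-below P
  exhausted-reading (reading {_} {_ ∷ _} {[]} P) _ _ with () ← Progress.rest-below P
  exhausted-reading (reading {_} {_} {_} {_ ∷ _} P) () _
  exhausted-reading (reading {_} {_ ∷ _} {_ ∷ _} {[]} P) () _
  exhausted-reading (reading {_} {_} {_} {[]} {_ ∷ _} P) _ ()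
  exhausted-reading (reading {_ ∷ _} {_} {_} {[]} {[]} P) _ ()

  drained-output : ∀ {out} → Draining (cfg [] [] out) →
                   ∃ λ Bts → Pointwise _↭_ Bts Bs × out ≡ concat Bts ++ reverse Ms
  drained-output (draining {Bts} {q} finished split output) =
    Bts , finished , trans output (cong (concat Bts ++_) (trans (sym (List.++-identityʳ q)) split))

  stack-at-maximum-push : Unique (assemble Ms Bs) → ∀ {x inp st out} →
    Reach T (assemble Ms Bs) (cfg (x ∷ inp) st out) → ¬ Forbidden T (x ∷ st) →
    (i : Fin (length Ms)) → x ≡ lookup Ms i → x ∷ st ≡ reverse (take (suc (toℕ i)) Ms)
  stack-at-maximum-push unique {x} {inp} {st} {out} reach accepted with invariant-run reach initial
  ... | inj₁ R = pushed-maximum-tops-maxima R pending-unique refl accepted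
    where
    pending-unique : Unique (pending (cfg (x ∷ inp) st out))
    pending-unique = run-keeps-pending-unique reach (subst Unique (sym (List.++-identityʳ _)) unique)

  output-blocks-then-maxima : ∀ {out} → Out T (assemble Ms Bs) out →
                              ∃ λ Bts → Pointwise _↭_ Bts Bs × out ≡ concat Bts ++ reverse Ms
  output-blocks-then-maxima run with invariant-run run initial
  ... | inj₁ R = drained-output (exhausted-reading R refl refl)
  ... | inj₂ D = drained-output D

  sortable-maxima-top-values : ∀ {n} → IsPerm n (assemble Ms Bs) → Sortable T (assemble Ms Bs) →
                               (j : Fin (length Ms)) → lookup Ms j ≡ n ∸ length Ms + suc (toℕ j)
  sortable-maxima-top-values {n} perm (o₁ , o₂ , run₁ , run₂ , o₂≡)
    with Bts , Bts↭Bs , o₁≡ ← output-blocks-then-maxima run₁ =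
    top-values n perm (assemble-↭ below) increasing
      (sortable-blocks-below-maxima below increasing Bts↭Bs (subst (λ o → Out (p21 ∷ []) o o₂) o₁≡ run₂)
        (subst (AllPairs _<_) (sym o₂≡) (AllPairsP.applyUpTo⁺₁ suc _ (λ i<j _ → s≤s i<j))))

mainTheorem9 : (k : ℕ) → 3 ≤ k → (σ : List ℕ) → IsPerm k σ → LastTwoAscending σ →
    (n : ℕ) → (π : List ℕ) → IsPerm n π →
    (Ms : List ℕ) → (Bs : List (List ℕ)) →
    Ms ≡ ltrMaxima π → length Bs ≡ length Ms → π ≡ concat (zipWith _∷_ Ms Bs) →
    -- (1a) whenever M_i is pushed, the stack is M_i, M_{i-1}, ..., M_1 (top to bottom)
    (∀ (x : ℕ) (inp st out : List ℕ) →
       Reach (p312 ∷ σ ∷ []) π (cfg (x ∷ inp) st out) →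
       ¬ Forbidden (p312 ∷ σ ∷ []) (x ∷ st) →
       (i : Fin (length Ms)) → x ≡ lookup Ms i →
       x ∷ st ≡ reverse (take (suc (toℕ i)) Ms))
    ×
    -- (1b) out^{312,σ}(π) = B̃_1 ⋯ B̃_t M_t ⋯ M_1 with B̃_i a rearrangement of B_i
    (∀ (out : List ℕ) → Out (p312 ∷ σ ∷ []) π out →
       ∃ λ (Bts : List (List ℕ)) →
         Pointwise _↭_ Bts Bs × out ≡ concat Bts ++ reverse Ms)
    ×
    -- (2) if π is {312,σ}-sortable then M_j = n - t + j
    (Sortable (p312 ∷ σ ∷ []) π →
       ∀ (j : Fin (length Ms)) → lookup Ms j ≡ n ∸ length Ms + suc (toℕ j))
mainTheorem9 k k≥3 σ σ-perm lta n π π-perm Ms Bs Ms≡ |Bs|≡|Ms| refl =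
  (λ _ _ _ _ → stack-at-maximum-push π-unique) ,
  (λ _ → output-blocks-then-maxima) ,
  sortable-maxima-top-values π-perm
  where
  π-unique : Unique π
  π-unique = Unique-resp-↭ (↭-sym π-perm) (UniqueP.applyUpTo⁺₁ suc n (λ i<j _ → ℕ.<⇒≢ i<j ∘ ℕ.suc-injective))
  long : 3 ≤ length σ
  long = subst (3 ≤_) (sym (trans (↭.↭-length σ-perm) (List.length-applyUpTo suc k))) k≥3
  decomposition : AllPairs _<_ Ms × BlocksBelow Ms Bs
  decomposition = ltrMaxima-decomposition Ms Bs |Bs|≡|Ms| π-unique (sym Ms≡)
  open 312σ-stack long lta (proj₂ decomposition) (proj₁ decomposition)
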